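{- Every caterpillar of diameter $4$ with an even number of edges is super edge-graceful.
   Context: A caterpillar is a tree such that removing all its leaves (endpoints) leaves a path. For a finite simple graph $G$ with $p$ vertices and $q$ edges, $G$ is called super edge-graceful if there is a bijection $f$ from $E(G)$ onto $\{0,\pm1,\ldots,\pm\frac{q-1}{2}\}$ when $q$ is odd, and onto $\{\pm1,\ldots,\pm\frac{q}{2}\}$ when $q$ is even, such that the induced vertex labeling $f^+(v)=\sum_{uv\in E(G)} f(uv)$ is a bijection from $V(G)$ onto $\{0,\pm1,\ldots,\pm\frac{p-1}{2}\}$ when $p$ is odd, and onto $\{\pm1,\ldots,\pm\frac{p}{2}\}$ when $p$ is even. -}

module Defs where

open import Data.Nat using (ℕ; zero; suc; _<_; _≤_; _+_; _*_; _/_; _%_)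
open import Data.Fin using (Fin; toℕ; _≟_)
open import Data.Integer using (ℤ; +_; -_)
import Data.Integer as ℤ
open import Data.List using (List; []; _∷_; length; lookup; map; filter; foldr; allFin; sum)
open import Data.List.Membership.Propositional using (_∈_)
open import Data.List.Relation.Unary.Unique.Propositional using (Unique)
open import Data.List.Relation.Binary.Permutation.Propositional using (_↭_)
open import Data.Product using (Σ; _×_; _,_; proj₁; proj₂; ∃)
open import Data.Sum using (_⊎_)
open import Relation.Nullary using (¬_; Dec)
open import Relation.Nullary.Decidable using (_⊎-dec_)
open import Relation.Binary.PropositionalEquality using (_≡_)
open import Function.Bundles using (_⇔_)
open import Function.Definitions using (Injective)

-- Each edge {u,v} is stored once, as the pair (u , v) with u < v
-- (so there are no loops), and the list has no repetitions
-- (so there are no multiple edges).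
record Graph (p : ℕ) : Set where
  field
    edges    : List (Fin p × Fin p)
    ordered  : ∀ {e} → e ∈ edges → toℕ (proj₁ e) < toℕ (proj₂ e)
    distinct : Unique edges

open Graph public

module _ {p : ℕ} (G : Graph p) where

  size : ℕ
  size = length (edges G)

  Adj : Fin p → Fin p → Set
  Adj u v = ((u , v) ∈ edges G) ⊎ ((v , u) ∈ edges G)

  incident? : (v : Fin p) (e : Fin p × Fin p) → Dec ((proj₁ e ≡ v) ⊎ (proj₂ e ≡ v))
  incident? v e = (proj₁ e ≟ v) ⊎-dec (proj₂ e ≟ v)

  degree : Fin p → ℕ
  degree v = length (filter (incident? v) (edges G))

  IsLeaf : Fin p → Set
  IsLeaf v = degree v ≡ 1

  data Walk : Fin p → Fin p → ℕ → Set where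
    here : ∀ {u} → Walk u u 0
    step : ∀ {u v w k} → Adj u v → Walk v w k → Walk u w (suc k)

  Connected : Set
  Connected = ∀ u v → ∃ λ k → Walk u v k

  record Cycle : Set where
    field
      m     : ℕ
      long  : 3 ≤ m
      c     : Fin m → Fin p
      inj   : Injective _≡_ _≡_ c
      cons  : ∀ (i j : Fin m) → toℕ j ≡ suc (toℕ i) → Adj (c i) (c j)
      close : ∀ (i j : Fin m) → toℕ i ≡ 0 → suc (toℕ j) ≡ m → Adj (c j) (c i)

  Acyclic : Set
  Acyclic = ¬ Cycle

  IsTree : Set
  IsTree = Connected × Acyclic

  HasDiameter : ℕ → Set
  HasDiameter d =
    (∀ u v → ∃ λ k → k ≤ d × Walk u v k) ×
    (∃ λ u → ∃ λ v → ∀ k → Walk u v k → d ≤ k)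

  -- removing all leaves leaves a path: the non-leaf vertices can be listed
  -- without repetition as w 0, …, w (m-1) so that two of them are adjacent
  -- exactly when they are consecutive in the listing
  LeavesRemovedIsPath : Set
  LeavesRemovedIsPath =
    Σ ℕ λ m → Σ (Fin m → Fin p) λ w →
      Injective _≡_ _≡_ w ×
      (∀ v → (¬ IsLeaf v) ⇔ (∃ λ i → w i ≡ v)) ×
      (∀ i j → Adj (w i) (w j) ⇔ ((toℕ j ≡ suc (toℕ i)) ⊎ (toℕ i ≡ suc (toℕ j))))

  IsCaterpillar : Set
  IsCaterpillar = IsTree × LeavesRemovedIsPath

pm : ℕ → List ℤ
pm zero    = []
pm (suc k) = + suc k ∷ - (+ suc k) ∷ pm k

labels : ℕ → List ℤ
labels n with n % 2
... | zero  = pm (n / 2)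
... | suc _ = + 0 ∷ pm (n / 2)

sumℤ : List ℤ → ℤ
sumℤ = foldr ℤ._+_ (+ 0)

module _ {p : ℕ} (G : Graph p) where

  inducedLabel : (Fin (size G) → ℤ) → Fin p → ℤ
  inducedLabel f v =
    sumℤ (map f (filter (λ i → incident? G v (lookup (edges G) i)) (allFin (size G))))

  SuperEdgeGraceful : Set
  SuperEdgeGraceful =
    Σ (Fin (size G) → ℤ) λ f →
      (map f (allFin (size G)) ↭ labels (size G)) ×
      (map (inducedLabel f) (allFin p) ↭ labels p)

module Submission where

-- Shape: the spine of such a caterpillar is a path w0 – w1 – w2 (a shorter spine
-- puts all vertices within distance three; a longer one puts the leaves at its
-- ends at distance at least five, by a height function growing by at most one
-- along edges); the other vertices are leaves, a, b, c of them at w0, w1, w2.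
-- Labelling: x on w0w1, y on w1w2 and lists LA, LB, LC on the pendant edges give
-- the leaves these labels and the spine vertices x + ΣLA, x + y + ΣLB, y + ΣLC;
-- so x, y, LA, LB, LC must be ±1, …, ±k and the spine sums 0, x, y.  As
-- a + b + c is even, a seed for the parities of a, b, c is completed by ± pairs.

open import Defs
open import Data.Nat using (ℕ; zero; suc; _+_; _*_; _/_; _%_; _<_; _≤_; z≤n; s≤s; pred)
import Data.Nat.Properties as ℕ
open import Data.Nat.DivMod using (m*n%n≡0; m*n/n≡m; [m+kn]%n≡m%n; +-distrib-/)
open import Data.Nat.ListAction using (sum)
open import Data.Nat.Tactic.RingSolver using (solve-∀)
open import Data.Fin using (Fin; zero; suc; toℕ; _≟_; fromℕ; inject₁)
import Data.Fin.Properties as Fin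
open import Data.Integer using (ℤ; +_; -_)
import Data.Integer as ℤ
import Data.Integer.Properties as ℤ
open import Data.Bool using (Bool; true; false; if_then_else_)
import Data.Bool as Bool
open import Data.Unit using (⊤; tt)
open import Data.Empty using (⊥; ⊥-elim)
open import Data.Product using (Σ; ∃; _×_; _,_; proj₁; proj₂)
open import Data.Product.Properties using (≡-dec)
open import Data.Sum using (_⊎_; inj₁; inj₂)
open import Data.List using (List; []; _∷_; _++_; [_]; length; lookup; map; filter; concat; tabulate; allFin)
open import Data.List.Properties
  using (++-assoc; ++-identityʳ; length-++; length-map; length-tabulate; map-++; map-∘; map-tabulate;
         tabulate-cong; filter-accept; filter-reject; filter-all; filter-none; ∷-injectiveˡ)
open import Data.List.Membership.Propositional using (_∈_)
open import Data.List.Membership.Propositional.Properties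
  using (∈-filter⁺; ∈-filter⁻; ∈-map⁺; ∈-map⁻; ∈-tabulate⁺; ∈-tabulate⁻; ∈-allFin)
open import Data.List.Membership.Propositional.Properties.WithK using (unique∧set⇒bag)
open import Data.List.Relation.Unary.Any using (here; there)
open import Data.List.Relation.Unary.All using (_∷_)
import Data.List.Relation.Unary.All as All
import Data.List.Relation.Unary.All.Properties as All
open import Data.List.Relation.Unary.AllPairs using ([]; _∷_)
open import Data.List.Relation.Unary.Unique.Propositional using (Unique)
import Data.List.Relation.Unary.Unique.Propositional.Properties as Unique
open import Data.List.Relation.Binary.Permutation.Propositional
  using (_↭_; ↭-refl; ↭-sym; ↭-trans; ↭-reflexive; prep; swap; module PermutationReasoning)
import Data.List.Relation.Binary.Permutation.Propositional as Perm
open import Data.List.Relation.Binary.Permutation.Propositional.Properties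
  using (shift; shifts; ++⁺; ++⁺ˡ; ++⁺ʳ; ++-comm; ↭-length)
import Data.List.Relation.Binary.Permutation.Propositional.Properties as Perm
open import Data.List.Relation.Binary.BagAndSetEquality using (∼bag⇒↭)
open import Function using (_∘_)
open import Function.Bundles using (_⇔_; Equivalence; mk⇔)
open import Function.Definitions using (Injective)
open import Relation.Nullary using (¬_; Dec; yes; no; does; ¬?)
open import Relation.Nullary.Decidable using (dec-true; dec-false; _⊎-dec_; _×-dec_)
open import Relation.Unary using (Decidable)
open import Relation.Binary.PropositionalEquality
  using (_≡_; _≢_; refl; sym; trans; cong; cong₂; cong-app; subst; subst₂; module ≡-Reasoning)

module _ {A : Set} where

  filter-cong : ∀ {P Q : A → Set} (P? : Decidable P) (Q? : Decidable Q) (xs : List A) →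
                (∀ {x} → x ∈ xs → does (P? x) ≡ does (Q? x)) → filter P? xs ≡ filter Q? xs
  filter-cong P? Q? [] same = refl
  -- (the cases where the decisions disagree are ruled out by `same`)
  filter-cong P? Q? (x ∷ xs) same with P? x | Q? x | same (here refl)
  ... | yes _ | yes _ | _ = cong (x ∷_) (filter-cong P? Q? xs (same ∘ there))
  ... | no  _ | no  _ | _ = filter-cong P? Q? xs (same ∘ there)

  filter-split : ∀ {P : A → Set} (P? : Decidable P) (xs : List A) →
                 xs ↭ filter P? xs ++ filter (¬? ∘ P?) xs
  filter-split P? [] = ↭-refl
  filter-split P? (x ∷ xs) with P? x
  ... | yes _ = prep x (filter-split P? xs)
  ... | no  _ = ↭-trans (prep x (filter-split P? xs)) (↭-sym (shift x (filter P? xs) _))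

  unique-↭ : ∀ {xs ys : List A} → Unique xs → Unique ys → (∀ {z} → z ∈ xs ⇔ z ∈ ys) → xs ↭ ys
  unique-↭ uxs uys same = ∼bag⇒↭ (unique∧set⇒bag uxs uys same)

  at-most-one : ∀ (xs : List A) → Unique xs → (∀ {x y} → x ∈ xs → y ∈ xs → x ≡ y) → length xs ≤ 1
  at-most-one [] _ _ = z≤n
  at-most-one (x ∷ []) _ _ = s≤s z≤n
  at-most-one (x ∷ y ∷ xs) ((x≢y ∷ _) ∷ _) allEqual = ⊥-elim (x≢y (allEqual (here refl) (there (here refl))))

  member⇒nonempty : ∀ {x : A} {xs} → x ∈ xs → 1 ≤ length xs
  member⇒nonempty (here _) = s≤s z≤n
  member⇒nonempty (there _) = s≤s z≤n

  only-member : ∀ {x : A} (xs : List A) → length xs ≡ 1 → x ∈ xs → xs ≡ x ∷ []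
  only-member (y ∷ []) _ (here refl) = refl

  singleton : ∀ (xs : List A) → length xs ≡ 1 → Σ A λ x → xs ≡ x ∷ []
  singleton (x ∷ []) _ = x , refl

  interchange : ∀ (a b c d : List A) → (a ++ b) ++ (c ++ d) ↭ (a ++ c) ++ (b ++ d)
  interchange a b c d = begin
    (a ++ b) ++ (c ++ d)  ≡⟨ ++-assoc a b (c ++ d) ⟩
    a ++ b ++ c ++ d      ↭⟨ ++⁺ˡ a (shifts b c) ⟩
    a ++ c ++ b ++ d      ≡⟨ ++-assoc a c (b ++ d) ⟨
    (a ++ c) ++ (b ++ d)  ∎
    where open PermutationReasoning

module _ {A B : Set} where

  filter-map : ∀ (h : A → B) {P : B → Set} (P? : Decidable P) (xs : List A) →
               filter P? (map h xs) ≡ map h (filter (P? ∘ h) xs)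
  filter-map h P? [] = refl
  filter-map h P? (x ∷ xs) with P? (h x)
  ... | yes _ = cong (h x ∷_) (filter-map h P? xs)
  ... | no  _ = filter-map h P? xs

  unique-map-on : ∀ {C : Set} (g : A → C) (f : A → B) {xs : List A} → Unique (map g xs) →
                  (∀ {x y} → x ∈ xs → y ∈ xs → f x ≡ f y → g x ≡ g y) → Unique (map f xs)
  unique-map-on g f {[]} [] _ = []
  unique-map-on g f {x ∷ xs} (gx∉ ∷ unique) injective =
    All.map⁺ (All.tabulate λ y∈ fx≡fy → All.lookup (All.map⁻ gx∉) y∈ (injective (here refl) (there y∈) fx≡fy))
    ∷ unique-map-on g f unique (λ x∈ y∈ → injective (there x∈) (there y∈))

  map-cong-∈ : ∀ (f g : A → B) (xs : List A) → (∀ {x} → x ∈ xs → f x ≡ g x) → map f xs ≡ map g xs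
  map-cong-∈ f g [] _ = refl
  map-cong-∈ f g (x ∷ xs) same = cong₂ _∷_ (same (here refl)) (map-cong-∈ f g xs (same ∘ there))

sumℤ-++ : ∀ (xs ys : List ℤ) → sumℤ (xs ++ ys) ≡ sumℤ xs ℤ.+ sumℤ ys
sumℤ-++ [] ys = sym (ℤ.+-identityˡ _)
sumℤ-++ (x ∷ xs) ys = trans (cong (λ s → x ℤ.+ s) (sumℤ-++ xs ys)) (sym (ℤ.+-assoc x _ _))

sumℤ-↭ : ∀ {xs ys : List ℤ} → xs ↭ ys → sumℤ xs ≡ sumℤ ys
sumℤ-↭ Perm.refl = refl
sumℤ-↭ (prep x p) = cong (λ s → x ℤ.+ s) (sumℤ-↭ p)
sumℤ-↭ (swap x y p) = begin
  x ℤ.+ (y ℤ.+ _)  ≡⟨ ℤ.+-assoc x y _ ⟨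
  x ℤ.+ y ℤ.+ _    ≡⟨ cong₂ ℤ._+_ (ℤ.+-comm x y) (sumℤ-↭ p) ⟩
  y ℤ.+ x ℤ.+ _    ≡⟨ ℤ.+-assoc y x _ ⟩
  y ℤ.+ (x ℤ.+ _)  ∎
  where open ≡-Reasoning
sumℤ-↭ (Perm.trans p q) = trans (sumℤ-↭ p) (sumℤ-↭ q)

withLabels : ∀ {A B : Set} (xs : List A) → (Fin (length xs) → B) → List (A × B)
withLabels [] f = []
withLabels (x ∷ xs) f = (x , f zero) ∷ withLabels xs (f ∘ suc)

module _ {A B : Set} where

  withLabels-entries : ∀ (xs : List A) (f : Fin (length xs) → B) → map proj₁ (withLabels xs f) ≡ xs
  withLabels-entries [] f = refl
  withLabels-entries (x ∷ xs) f = cong (x ∷_) (withLabels-entries xs (f ∘ suc))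

  labels-where : ∀ (xs : List A) (f : Fin (length xs) → B) {P : A → Set} (P? : Decidable P) →
                 map f (filter (P? ∘ lookup xs) (allFin (length xs))) ≡
                 map proj₂ (filter (P? ∘ proj₁) (withLabels xs f))
  labels-later : ∀ x (xs : List A) (f : Fin (suc (length xs)) → B) {P : A → Set} (P? : Decidable P) →
                 map f (filter (P? ∘ lookup (x ∷ xs)) (tabulate suc)) ≡
                 map proj₂ (filter (P? ∘ proj₁) (withLabels xs (f ∘ suc)))

  labels-where [] f P? = refl
  labels-where (x ∷ xs) f P? with P? x
  ... | yes _ = cong (f zero ∷_) (labels-later x xs f P?)
  ... | no _ = labels-later x xs f P?

  labels-later x xs f P? = begin
    map f (filter (P? ∘ lookup (x ∷ xs)) (tabulate suc))
      ≡⟨ cong (map f ∘ filter (P? ∘ lookup (x ∷ xs))) (map-tabulate (λ i → i) suc) ⟨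
    map f (filter (P? ∘ lookup (x ∷ xs)) (map suc (allFin _)))
      ≡⟨ cong (map f) (filter-map suc (P? ∘ lookup (x ∷ xs)) (allFin _)) ⟩
    map f (map suc (filter (P? ∘ lookup xs) (allFin _)))
      ≡⟨ map-∘ (filter (P? ∘ lookup xs) (allFin _)) ⟨
    map (f ∘ suc) (filter (P? ∘ lookup xs) (allFin _))
      ≡⟨ labels-where xs (f ∘ suc) P? ⟩
    map proj₂ (filter (P? ∘ proj₁) (withLabels xs (f ∘ suc)))  ∎
    where open ≡-Reasoning

blocks-insert : ∀ {A : Set} {n} (c : Fin n) (F F′ : Fin n → List A) (extra : List A) →
                (∀ X → X ≢ c → F X ≡ F′ X) → F c ≡ extra ++ F′ c →
                concat (tabulate F) ↭ extra ++ concat (tabulate F′)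
blocks-insert zero F F′ extra others at-c = ↭-reflexive (begin
  F zero ++ concat (tabulate (F ∘ suc))             ≡⟨ cong₂ _++_ at-c (cong concat (tabulate-cong (λ X → others (suc X) λ ()))) ⟩
  (extra ++ F′ zero) ++ concat (tabulate (F′ ∘ suc)) ≡⟨ ++-assoc extra (F′ zero) _ ⟩
  extra ++ F′ zero ++ concat (tabulate (F′ ∘ suc))   ∎)
  where open ≡-Reasoning
blocks-insert (suc c) F F′ extra others at-c = begin
  F zero ++ concat (tabulate (F ∘ suc))            ≡⟨ cong (_++ _) (others zero λ ()) ⟩
  F′ zero ++ concat (tabulate (F ∘ suc))
    ↭⟨ ++⁺ˡ (F′ zero) (blocks-insert c (F ∘ suc) (F′ ∘ suc) extra (λ X X≢c → others (suc X) (X≢c ∘ Fin.suc-injective)) at-c) ⟩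
  F′ zero ++ extra ++ concat (tabulate (F′ ∘ suc)) ↭⟨ shifts (F′ zero) extra ⟩
  extra ++ F′ zero ++ concat (tabulate (F′ ∘ suc)) ∎
  where open PermutationReasoning

blocks-empty : ∀ {A : Set} {n} (F : Fin n → List A) → (∀ X → F X ≡ []) → concat (tabulate F) ≡ []
blocks-empty {n = zero} F empty = refl
blocks-empty {n = suc n} F empty = cong₂ _++_ (empty zero) (blocks-empty (F ∘ suc) (empty ∘ suc))

-- The elements of a list over E are sorted into kinds Fin n.  Each kind has a pool
-- of labels, and going through the list every element takes the next label
-- from the pool of its kind.  When every pool has exactly the size of its
-- kind, the labels given to the elements of any set of kinds are, up to
-- order, the pools of those kinds (`dealt`).
module Dealing {E : Set} {n : ℕ} (kind : E → Fin n) where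

  ofKind : Fin n → List E → List E
  ofKind X = filter (λ e → kind e ≟ X)

  count : Fin n → List E → ℕ
  count X xs = length (ofKind X xs)

  ofKind-here : ∀ e xs → ofKind (kind e) (e ∷ xs) ≡ e ∷ ofKind (kind e) xs
  ofKind-here e xs = filter-accept (λ e → kind e ≟ _) refl

  ofKind-other : ∀ {X} e xs → X ≢ kind e → ofKind X (e ∷ xs) ≡ ofKind X xs
  ofKind-other e xs X≢ = filter-reject (λ e → kind e ≟ _) (X≢ ∘ sym)

  by-kind : ∀ xs → xs ↭ concat (tabulate (λ X → ofKind X xs))
  by-kind [] = ↭-reflexive (sym (blocks-empty (λ X → ofKind X []) λ _ → refl))
  by-kind (e ∷ xs) = ↭-trans (prep e (by-kind xs))
    (↭-sym (blocks-insert (kind e) (λ X → ofKind X (e ∷ xs)) (λ X → ofKind X xs) [ e ]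
              (λ X → ofKind-other e xs) (ofKind-here e xs)))

  count-total : ∀ xs → length xs ≡ sum (tabulate (λ X → count X xs))
  count-total xs = trans (↭-length (by-kind xs)) (length-blocks (λ X → ofKind X xs))
    where
    length-blocks : ∀ {m} (F : Fin m → List E) → length (concat (tabulate F)) ≡ sum (tabulate (length ∘ F))
    length-blocks {zero} F = refl
    length-blocks {suc m} F = trans (length-++ (F zero)) (cong (λ s → length (F zero) + s) (length-blocks (F ∘ suc)))

  Pools : Set
  Pools = Fin n → List ℤ

  firstOr0 : List ℤ → ℤ
  firstOr0 [] = + 0
  firstOr0 (a ∷ _) = a

  rest : List ℤ → List ℤ
  rest [] = []
  rest (_ ∷ as) = as

  handOut : Fin n → Pools → Pools
  handOut c L X with X ≟ c
  ... | yes _ = rest (L X)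
  ... | no  _ = L X

  deal : Pools → (xs : List E) → Fin (length xs) → ℤ
  deal L (e ∷ xs) zero = firstOr0 (L (kind e))
  deal L (e ∷ xs) (suc i) = deal (handOut (kind e) L) xs i

  pick : ∀ {P : Fin n → Set} → Decidable P → Pools → Fin n → List ℤ
  pick P? L X = if does (P? X) then L X else []

  handOut-here : ∀ c L → handOut c L c ≡ rest (L c)
  handOut-here c L with c ≟ c
  ... | yes _ = refl
  ... | no c≢c = ⊥-elim (c≢c refl)

  handOut-other : ∀ {c X} L → X ≢ c → handOut c L X ≡ L X
  handOut-other {c} {X} L X≢c with X ≟ c
  ... | yes X≡c = ⊥-elim (X≢c X≡c)
  ... | no _ = refl

  dealt : ∀ {P : Fin n → Set} (P? : Decidable P) (L : Pools) (xs : List E) →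
          (∀ X → length (L X) ≡ count X xs) →
          map proj₂ (filter (P? ∘ kind ∘ proj₁) (withLabels xs (deal L xs))) ↭ concat (tabulate (pick P? L))
  dealt P? L [] sizes = ↭-reflexive (sym (blocks-empty (pick P? L) λ X → pick-empty X (length-0 (sizes X))))
    where
    length-0 : ∀ {ys : List ℤ} → length ys ≡ 0 → ys ≡ []
    length-0 {[]} _ = refl
    pick-empty : ∀ X → L X ≡ [] → pick P? L X ≡ []
    pick-empty X empty with does (P? X)
    ... | true = empty
    ... | false = refl
  dealt P? L (e ∷ xs) sizes = begin
    map proj₂ (filter Q ((e , a) ∷ W))     ≡⟨ front ⟩
    extra ++ map proj₂ (filter Q W)        ↭⟨ ++⁺ˡ extra (dealt P? (handOut c L) xs sizes′) ⟩
    extra ++ concat (tabulate (pick P? (handOut c L)))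
      ↭⟨ blocks-insert c (pick P? L) (pick P? (handOut c L)) extra
           (λ X X≢c → cong (λ ys → if does (P? X) then ys else []) (sym (handOut-other L X≢c))) pick-here ⟨
    concat (tabulate (pick P? L))          ∎
    where
    open PermutationReasoning
    c = kind e
    a = firstOr0 (L c)
    Q = P? ∘ kind ∘ proj₁
    W = withLabels xs (deal (handOut c L) xs)
    extra = if does (P? c) then [ a ] else []
    -- the pool of c is nonempty, as e has kind c
    pool-c : L c ≡ a ∷ rest (L c)
    pool-c with L c | sizes c
    ... | a′ ∷ as | _ = refl
    ... | [] | size rewrite ofKind-here e xs with () ← size
    front : map proj₂ (filter Q ((e , a) ∷ W)) ≡ extra ++ map proj₂ (filter Q W)
    front with P? c
    ... | yes _ = refl
    ... | no _ = refl
    pick-here : pick P? L c ≡ extra ++ pick P? (handOut c L) c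
    pick-here with P? c
    ... | yes _ = trans pool-c (cong (a ∷_) (sym (handOut-here c L)))
    ... | no _ = refl
    sizes′ : ∀ X → length (handOut c L X) ≡ count X xs
    sizes′ X with X ≟ c
    ... | no X≢c = trans (sizes X) (cong length (ofKind-other e xs X≢c))
    ... | yes refl = cong pred (trans (cong length (sym pool-c)) (trans (sizes c) (cong length (ofKind-here e xs))))

pairs : ℕ → ℕ → List ℤ
pairs o zero = []
pairs o (suc h) = + o ∷ - (+ o) ∷ pairs (suc o) h

pairs-++ : ∀ o h h′ → pairs o h ++ pairs (o + h) h′ ≡ pairs o (h + h′)
pairs-++ o zero h′ = cong (λ o′ → pairs o′ h′) (ℕ.+-identityʳ o)
pairs-++ o (suc h) h′ = cong (λ ps → + o ∷ - (+ o) ∷ ps)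
  (trans (cong (λ o′ → pairs (suc o) h ++ pairs o′ h′) (ℕ.+-suc o h)) (pairs-++ (suc o) h h′))

length-pairs : ∀ o h → length (pairs o h) ≡ h + h
length-pairs o zero = refl
length-pairs o (suc h) = cong suc (trans (cong suc (length-pairs (suc o) h)) (sym (ℕ.+-suc h h)))

-- Each pair contributes o + (-o) = 0, so padding a list with pairs keeps its sum.
sumℤ-pad : ∀ s o h → sumℤ (s ++ pairs o h) ≡ sumℤ s
sumℤ-pad s o h = trans (sumℤ-++ s (pairs o h)) (trans (cong (λ t → sumℤ s ℤ.+ t) (pairs-zero o h)) (ℤ.+-identityʳ (sumℤ s)))
  where
  pairs-zero : ∀ o h → sumℤ (pairs o h) ≡ + 0
  pairs-zero o zero = refl
  pairs-zero o (suc h) = begin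
    + o ℤ.+ (- (+ o) ℤ.+ sumℤ (pairs (suc o) h))  ≡⟨ ℤ.+-assoc (+ o) (- (+ o)) _ ⟨
    (+ o ℤ.+ - (+ o)) ℤ.+ sumℤ (pairs (suc o) h)  ≡⟨ cong₂ ℤ._+_ (ℤ.+-inverseʳ (+ o)) (pairs-zero (suc o) h) ⟩
    + 0  ∎
    where open ≡-Reasoning

pm↭pairs : ∀ k → pm k ↭ pairs 1 k
pm↭pairs zero = ↭-refl
pm↭pairs (suc k) = begin
  + suc k ∷ - (+ suc k) ∷ pm k  ↭⟨ prep _ (prep _ (pm↭pairs k)) ⟩
  pairs (1 + k) 1 ++ pairs 1 k  ↭⟨ ++-comm (pairs (1 + k) 1) (pairs 1 k) ⟩
  pairs 1 k ++ pairs (1 + k) 1  ≡⟨ pairs-++ 1 k 1 ⟩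
  pairs 1 (k + 1)               ≡⟨ cong (pairs 1) (ℕ.+-comm k 1) ⟩
  pairs 1 (suc k)               ∎
  where open PermutationReasoning

labels-even : ∀ k → labels (2 * k) ≡ pm k
labels-even k = trans (by-remainder (2 * k) (trans (cong (_% 2) (ℕ.*-comm 2 k)) (m*n%n≡0 k 2)))
                      (cong pm (trans (cong (_/ 2) (ℕ.*-comm 2 k)) (m*n/n≡m k 2)))
  where
  by-remainder : ∀ n → n % 2 ≡ 0 → labels n ≡ pm (n / 2)
  by-remainder n r with n % 2
  ... | zero = refl

labels-odd : ∀ k → labels (suc (2 * k)) ≡ + 0 ∷ pm k
labels-odd k = begin
  labels (1 + 2 * k)       ≡⟨ cong (λ m → labels (1 + m)) (ℕ.*-comm 2 k) ⟩
  labels (1 + k * 2)       ≡⟨ by-remainder (1 + k * 2) ([m+kn]%n≡m%n 1 k 2) ⟩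
  + 0 ∷ pm ((1 + k * 2) / 2) ≡⟨ cong (λ h → + 0 ∷ pm h) half ⟩
  + 0 ∷ pm k               ∎
  where
  by-remainder : ∀ n → n % 2 ≡ 1 → labels n ≡ + 0 ∷ pm (n / 2)
  by-remainder n r with n % 2
  ... | suc zero = refl
  half : (1 + k * 2) / 2 ≡ k
  half = trans (+-distrib-/ 1 (k * 2) (subst (λ r → 1 + r < 2) (sym (m*n%n≡0 k 2)) (s≤s (s≤s z≤n)))) (m*n/n≡m k 2)
  open ≡-Reasoning

data Parity : ℕ → Set where
  even : ∀ h → Parity (h + h)
  odd  : ∀ h → Parity (suc (h + h))

parity : ∀ n → Parity n
parity zero = even 0
parity (suc n) with parity n
... | even h = odd h
... | odd h = subst Parity (cong suc (ℕ.+-suc h h)) (even (suc h))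

-- Labels for a spine w0 – w1 – w2 carrying a, b, c pendant edges at w0, w1, w2:
-- x on w0w1, y on w1w2, and the lists LA, LB, LC on the pendant edges.  All edge
-- labels together are ±1, …, ±k, and the spine vertices receive 0, x and y, so
-- together with the pendant vertices (which inherit their edge's label) the
-- vertex labels are 0, ±1, …, ±k.
record Design (a b c k : ℕ) : Set where
  field
    x y : ℤ
    LA LB LC : List ℤ
    size-A : length LA ≡ a
    size-B : length LB ≡ b
    size-C : length LC ≡ c
    edge-labels : x ∷ y ∷ LA ++ LB ++ LC ↭ pm k
    spine-sums : (x ℤ.+ sumℤ LA) ∷ (x ℤ.+ (y ℤ.+ sumℤ LB)) ∷ (y ℤ.+ sumℤ LC) ∷ [] ↭ + 0 ∷ x ∷ y ∷ []

-- They are ±1, …, ±t.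
record Seed (ra rb rc : ℕ) : Set where
  field
    x y : ℤ
    sA sB sC : List ℤ
    size-A : length sA ≡ ra
    size-B : length sB ≡ rb
    size-C : length sC ≡ rc
    t : ℕ
    twice-t : 2 * t ≡ 2 + ra + rb + rc
    seed-labels : x ∷ y ∷ sA ++ sB ++ sC ↭ pairs 1 t
    seed-sums : (x ℤ.+ sumℤ sA) ∷ (x ℤ.+ (y ℤ.+ sumℤ sB)) ∷ (y ℤ.+ sumℤ sC) ∷ [] ↭ + 0 ∷ x ∷ y ∷ []

-- The four seeds, one for each parity pattern with an even number of edges.
seed-eee : Seed 0 0 0
seed-eee = record
  { x = + 1 ; y = - (+ 1) ; sA = [] ; sB = [] ; sC = []
  ; size-A = refl ; size-B = refl ; size-C = refl ; t = 1 ; twice-t = refl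
  ; seed-labels = ↭-refl ; seed-sums = swap _ _ ↭-refl }

seed-oeo : Seed 1 0 1
seed-oeo = record
  { x = + 1 ; y = - (+ 1) ; sA = - (+ 2) ∷ [] ; sB = [] ; sC = + 2 ∷ []
  ; size-A = refl ; size-B = refl ; size-C = refl ; t = 2 ; twice-t = refl
  ; seed-labels = prep _ (prep _ (swap _ _ ↭-refl))
  ; seed-sums = ↭-trans (swap _ _ ↭-refl) (prep _ (swap _ _ ↭-refl)) }

seed-ooe : Seed 1 1 0
seed-ooe = record
  { x = + 1 ; y = + 2 ; sA = - (+ 1) ∷ [] ; sB = - (+ 2) ∷ [] ; sC = []
  ; size-A = refl ; size-B = refl ; size-C = refl ; t = 2 ; twice-t = refl
  ; seed-labels = prep _ (swap _ _ ↭-refl) ; seed-sums = ↭-refl }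

seed-eoo : Seed 0 1 1
seed-eoo = record
  { x = + 1 ; y = + 2 ; sA = [] ; sB = - (+ 1) ∷ [] ; sC = - (+ 2) ∷ []
  ; size-A = refl ; size-B = refl ; size-C = refl ; t = 2 ; twice-t = refl
  ; seed-labels = prep _ (swap _ _ ↭-refl)
  ; seed-sums = ↭-trans (prep _ (swap _ _ ↭-refl)) (swap _ _ ↭-refl) }

regroup : ∀ ra rb rc ha hb hc →
          2 + ra + rb + rc + 2 * (ha + (hb + hc)) ≡ 2 + (ra + (ha + ha)) + (rb + (hb + hb)) + (rc + (hc + hc))
regroup = solve-∀

-- A seed extends to all pendant counts of the same parities: the remaining
-- pendant labels are handed out in ± pairs, which leave every sum unchanged.
grow : ∀ {ra rb rc} → Seed ra rb rc → ∀ ha hb hc k →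
       2 + (ra + (ha + ha)) + (rb + (hb + hb)) + (rc + (hc + hc)) ≡ 2 * k →
       Design (ra + (ha + ha)) (rb + (hb + hb)) (rc + (hc + hc)) k
grow {ra} {rb} {rc} s ha hb hc k total = record
  { x = x ; y = y ; LA = sA ++ PA ; LB = sB ++ PB ; LC = sC ++ PC
  ; size-A = padded-size sA (1 + t) ha size-A ; size-B = padded-size sB (1 + t + ha) hb size-B
  ; size-C = padded-size sC (1 + t + ha + hb) hc size-C
  ; edge-labels = labels-ok
  ; spine-sums = ↭-trans (↭-reflexive padded-sums) seed-sums
  }
  where
  open Seed s
  PA = pairs (1 + t) ha
  PB = pairs (1 + t + ha) hb
  PC = pairs (1 + t + ha + hb) hc
  m = ha + (hb + hc)

  padded-sums : (x ℤ.+ sumℤ (sA ++ PA)) ∷ (x ℤ.+ (y ℤ.+ sumℤ (sB ++ PB))) ∷ (y ℤ.+ sumℤ (sC ++ PC)) ∷ [] ≡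
                (x ℤ.+ sumℤ sA) ∷ (x ℤ.+ (y ℤ.+ sumℤ sB)) ∷ (y ℤ.+ sumℤ sC) ∷ []
  padded-sums = cong₂ (λ u vw → (x ℤ.+ u) ∷ vw) (sumℤ-pad sA (1 + t) ha)
                  (cong₂ (λ v w → (x ℤ.+ (y ℤ.+ v)) ∷ (y ℤ.+ w) ∷ []) (sumℤ-pad sB (1 + t + ha) hb) (sumℤ-pad sC (1 + t + ha + hb) hc))

  padded-size : ∀ {r} (sX : List ℤ) o h → length sX ≡ r → length (sX ++ pairs o h) ≡ r + (h + h)
  padded-size sX o h eq = trans (length-++ sX) (cong₂ _+_ eq (length-pairs o h))

  -- k labels pairs: t in the seed and m more
  k≡ : t + m ≡ k
  k≡ = ℕ.*-cancelˡ-≡ (t + m) k 2 (begin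
    2 * (t + m)                 ≡⟨ ℕ.*-distribˡ-+ 2 t m ⟩
    2 * t + 2 * m               ≡⟨ cong (_+ 2 * m) twice-t ⟩
    2 + ra + rb + rc + 2 * m    ≡⟨ regroup ra rb rc ha hb hc ⟩
    _                           ≡⟨ total ⟩
    2 * k                       ∎)
    where open ≡-Reasoning

  labels-ok : x ∷ y ∷ (sA ++ PA) ++ (sB ++ PB) ++ (sC ++ PC) ↭ pm k
  labels-ok = begin
    x ∷ y ∷ (sA ++ PA) ++ (sB ++ PB) ++ (sC ++ PC)    ↭⟨ prep x (prep y (++⁺ˡ (sA ++ PA) (interchange sB PB sC PC))) ⟩
    x ∷ y ∷ (sA ++ PA) ++ (sB ++ sC) ++ (PB ++ PC)    ↭⟨ prep x (prep y (interchange sA PA (sB ++ sC) (PB ++ PC))) ⟩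
    (x ∷ y ∷ sA ++ sB ++ sC) ++ PA ++ PB ++ PC        ↭⟨ ++⁺ʳ (PA ++ PB ++ PC) seed-labels ⟩
    pairs 1 t ++ PA ++ PB ++ PC                       ≡⟨ cong (λ ps → pairs 1 t ++ PA ++ ps) (pairs-++ (1 + t + ha) hb hc) ⟩
    pairs 1 t ++ PA ++ pairs (1 + t + ha) (hb + hc)   ≡⟨ cong (pairs 1 t ++_) (pairs-++ (1 + t) ha (hb + hc)) ⟩
    pairs 1 t ++ pairs (1 + t) m                      ≡⟨ pairs-++ 1 t m ⟩
    pairs 1 (t + m)                                   ≡⟨ cong (pairs 1) k≡ ⟩
    pairs 1 k                                         ↭⟨ pm↭pairs k ⟨
    pm k                                              ∎
    where open PermutationReasoning

-- An even number of edges leaves an even number of odd pendant counts.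
odd-excluded : ∀ r M k → 2 + suc (2 * r) + 2 * M ≢ 2 * k
odd-excluded r M k total = ℕ.even≢odd k (1 + r + M) (trans (sym total) (as-odd r M))
  where
  as-odd : ∀ r M → 2 + suc (2 * r) + 2 * M ≡ suc (2 * (1 + r + M))
  as-odd = solve-∀

design : ∀ a b c k → 2 + a + b + c ≡ 2 * k → Design a b c k
design a b c k total with parity a | parity b | parity c
... | even ha | even hb | even hc = grow seed-eee ha hb hc k total
... | odd ha  | even hb | odd hc  = grow seed-oeo ha hb hc k total
... | odd ha  | odd hb  | even hc = grow seed-ooe ha hb hc k total
... | even ha | odd hb  | odd hc  = grow seed-eoo ha hb hc k total
... | odd ha  | even hb | even hc = ⊥-elim (odd-excluded 0 (ha + (hb + hc)) k (trans (regroup 1 0 0 ha hb hc) total))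
... | even ha | odd hb  | even hc = ⊥-elim (odd-excluded 0 (ha + (hb + hc)) k (trans (regroup 0 1 0 ha hb hc) total))
... | even ha | even hb | odd hc  = ⊥-elim (odd-excluded 0 (ha + (hb + hc)) k (trans (regroup 0 0 1 ha hb hc) total))
... | odd ha  | odd hb  | odd hc  = ⊥-elim (odd-excluded 1 (ha + (hb + hc)) k (trans (regroup 1 1 1 ha hb hc) total))

length-pm : ∀ k → length (pm k) ≡ 2 * k
length-pm zero = refl
length-pm (suc k) = trans (cong (λ n → suc (suc n)) (length-pm k)) (sym (ℕ.*-suc 2 k))

module GraphFacts {p : ℕ} (G : Graph p) where

  Edge : Set
  Edge = Fin p × Fin p

  Incident : Fin p → Edge → Set
  Incident v e = (proj₁ e ≡ v) ⊎ (proj₂ e ≡ v)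

  Joins : Fin p → Fin p → Edge → Set
  Joins u v e = (e ≡ (u , v)) ⊎ (e ≡ (v , u))

  adj-sym : ∀ {u v} → Adj G u v → Adj G v u
  adj-sym (inj₁ uv) = inj₂ uv
  adj-sym (inj₂ vu) = inj₁ vu

  adj? : ∀ u v → Dec (Adj G u v)
  adj? u v = ((u , v) ∈? edges G) ⊎-dec ((v , u) ∈? edges G)
    where open import Data.List.Membership.DecPropositional (≡-dec _≟_ _≟_) using (_∈?_)

  ends-differ : ∀ {e} → e ∈ edges G → proj₁ e ≢ proj₂ e
  ends-differ e∈ same = ℕ.<-irrefl (cong toℕ same) (ordered G e∈)

  joins : ∀ {u v e} → Incident u e → Incident v e → u ≢ v → Joins u v e
  joins (inj₁ refl) (inj₁ refl) u≢v = ⊥-elim (u≢v refl)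
  joins (inj₁ refl) (inj₂ refl) u≢v = inj₁ refl
  joins (inj₂ refl) (inj₁ refl) u≢v = inj₂ refl
  joins (inj₂ refl) (inj₂ refl) u≢v = ⊥-elim (u≢v refl)

  joins⇒adj : ∀ {u v e} → e ∈ edges G → Joins u v e → Adj G u v
  joins⇒adj e∈ (inj₁ refl) = inj₁ e∈
  joins⇒adj e∈ (inj₂ refl) = inj₂ e∈

  adj⇒edge : ∀ {u v} → Adj G u v → Σ Edge λ e → e ∈ edges G × Joins u v e
  adj⇒edge (inj₁ uv) = _ , uv , inj₁ refl
  adj⇒edge (inj₂ vu) = _ , vu , inj₂ refl

  joins-ends : ∀ {u v e} → Joins u v e → Incident u e × Incident v e
  joins-ends (inj₁ refl) = inj₁ refl , inj₂ refl
  joins-ends (inj₂ refl) = inj₂ refl , inj₁ refl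

  joins-only : ∀ {u v x e} → Joins u v e → x ≢ u → x ≢ v → ¬ Incident x e
  joins-only (inj₁ refl) x≢u x≢v (inj₁ refl) = x≢u refl
  joins-only (inj₁ refl) x≢u x≢v (inj₂ refl) = x≢v refl
  joins-only (inj₂ refl) x≢u x≢v (inj₁ refl) = x≢v refl
  joins-only (inj₂ refl) x≢u x≢v (inj₂ refl) = x≢u refl

  no-three-ends : ∀ {u v w e} → Incident u e → Incident v e → Incident w e → u ≢ v → u ≢ w → v ≢ w → ⊥
  no-three-ends u∈ v∈ (inj₁ refl) u≢v u≢w v≢w with joins u∈ v∈ u≢v
  ... | inj₁ refl = u≢w refl
  ... | inj₂ refl = v≢w refl
  no-three-ends u∈ v∈ (inj₂ refl) u≢v u≢w v≢w with joins u∈ v∈ u≢v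
  ... | inj₁ refl = v≢w refl
  ... | inj₂ refl = u≢w refl

  -- two vertices are joined by at most one edge, since each edge is stored
  -- once and in increasing order
  joining-unique : ∀ {u v e e′} → e ∈ edges G → e′ ∈ edges G → Joins u v e → Joins u v e′ → e ≡ e′
  joining-unique _ _ (inj₁ refl) (inj₁ refl) = refl
  joining-unique _ _ (inj₂ refl) (inj₂ refl) = refl
  joining-unique e∈ e′∈ (inj₁ refl) (inj₂ refl) = ⊥-elim (ℕ.<-asym (ordered G e∈) (ordered G e′∈))
  joining-unique e∈ e′∈ (inj₂ refl) (inj₁ refl) = ⊥-elim (ℕ.<-asym (ordered G e∈) (ordered G e′∈))

  at-most-one-joining : ∀ {u v} (es : List Edge) → Unique es → (∀ {e} → e ∈ es → e ∈ edges G × Joins u v e) →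
                        length es ≤ 1
  at-most-one-joining es unique joining = at-most-one es unique λ e∈ e′∈ →
    joining-unique (proj₁ (joining e∈)) (proj₁ (joining e′∈)) (proj₂ (joining e∈)) (proj₂ (joining e′∈))

  other-end : Fin p → Edge → Fin p
  other-end v (a , b) with a ≟ v
  ... | yes _ = b
  ... | no _ = a

  other-end-incident : ∀ v e → Incident (other-end v e) e
  other-end-incident v (a , b) with a ≟ v
  ... | yes _ = inj₂ refl
  ... | no _ = inj₁ refl

  other-end-differs : ∀ {v e} → e ∈ edges G → other-end v e ≢ v
  other-end-differs {v} {a , b} e∈ with a ≟ v
  ... | yes refl = ends-differ e∈ ∘ sym
  ... | no a≢v = a≢v

  other-end-is : ∀ {v u e} → Incident v e → Incident u e → u ≢ v → other-end v e ≡ u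
  other-end-is {v} v∈e u∈e u≢v with joins v∈e u∈e (u≢v ∘ sym)
  ... | inj₁ refl with v ≟ v
  ...   | yes _ = refl
  ...   | no v≢v = ⊥-elim (v≢v refl)
  other-end-is {v} {u} v∈e u∈e u≢v | inj₂ refl with u ≟ v
  ...   | yes u≡v = ⊥-elim (u≢v u≡v)
  ...   | no _ = refl

  incidentEdges : Fin p → List Edge
  incidentEdges v = filter (incident? G v) (edges G)

  incidentEdges-unique : ∀ v → Unique (incidentEdges v)
  incidentEdges-unique v = Unique.filter⁺ (incident? G v) (distinct G)

  degree-one : ∀ {v u} → Adj G v u → (∀ y → Adj G v y → y ≡ u) → degree G v ≡ 1
  degree-one {v} {u} v~u only-u = ℕ.≤-antisym
    (at-most-one-joining (incidentEdges v) (incidentEdges-unique v) toward-u)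
    (member⇒nonempty (∈-filter⁺ (incident? G v) e∈ (proj₁ (joins-ends e∈v))))
    where
    e∈ = proj₁ (proj₂ (adj⇒edge v~u))
    e∈v = proj₂ (proj₂ (adj⇒edge v~u))
    toward-u : ∀ {e} → e ∈ incidentEdges v → e ∈ edges G × Joins v u e
    toward-u e∈ with ∈-filter⁻ (incident? G v) e∈
    ... | e∈G , inj₁ refl = e∈G , inj₁ (cong (_ ,_) (only-u _ (inj₁ e∈G)))
    ... | e∈G , inj₂ refl = e∈G , inj₂ (cong (_, _) (only-u _ (inj₂ e∈G)))

  leaf-edge : ∀ {v e e′} → IsLeaf G v → e ∈ edges G → e′ ∈ edges G → Incident v e → Incident v e′ → e ≡ e′
  leaf-edge {v} leaf e∈ e′∈ v∈e v∈e′ = ∷-injectiveˡ (trans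
    (sym (only-member (incidentEdges v) leaf (∈-filter⁺ (incident? G v) e∈ v∈e)))
    (only-member (incidentEdges v) leaf (∈-filter⁺ (incident? G v) e′∈ v∈e′)))

  leaf-neighbour : ∀ {v} → IsLeaf G v → Σ (Fin p) λ y → Adj G v y
  leaf-neighbour {v} leaf with singleton (incidentEdges v) leaf
  ... | e , is-only with ∈-filter⁻ (incident? G v) (subst (e ∈_) (sym is-only) (here refl))
  ... | e∈ , inj₁ refl = proj₂ e , inj₁ e∈
  ... | e∈ , inj₂ refl = proj₁ e , inj₂ e∈

  leaf-neighbour-unique : ∀ {v y y′} → IsLeaf G v → Adj G v y → Adj G v y′ → y ≡ y′
  leaf-neighbour-unique leaf v~y v~y′ with adj⇒edge v~y | adj⇒edge v~y′
  ... | e , e∈ , j | e′ , e′∈ , j′ with leaf-edge leaf e∈ e′∈ (proj₁ (joins-ends j)) (proj₁ (joins-ends j′))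
  ... | same = far-end j j′ same
    where
    far-end : ∀ {v y y′ e e′} → Joins v y e → Joins v y′ e′ → e ≡ e′ → y ≡ y′
    far-end (inj₁ refl) (inj₁ refl) same = cong proj₂ same
    far-end (inj₁ refl) (inj₂ refl) same = trans (cong proj₂ same) (cong proj₁ same)
    far-end (inj₂ refl) (inj₁ refl) same = trans (cong proj₁ same) (cong proj₂ same)
    far-end (inj₂ refl) (inj₂ refl) same = cong proj₁ same

  _++ʷ_ : ∀ {x y z k l} → Walk G x y k → Walk G y z l → Walk G x z (k + l)
  here ++ʷ w = w
  step a v ++ʷ w = step a (v ++ʷ w)

  reverseʷ : ∀ {x y k} → Walk G x y k → Walk G y x k
  reverseʷ here = here
  reverseʷ {k = suc k} (step a w) = subst (Walk G _ _) (ℕ.+-comm k 1) (reverseʷ w ++ʷ step (adj-sym a) here)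

  -- In a connected graph with two vertices at distance at least two, no edge
  -- joins two leaves: such an edge would form a connected component by itself.
  spread⇒no-leaf-edge : Connected G → (∃ λ u → ∃ λ v → ∀ k → Walk G u v k → 2 ≤ k) →
                 ∀ {e} → e ∈ edges G → IsLeaf G (proj₁ e) → IsLeaf G (proj₂ e) → ⊥
  spread⇒no-leaf-edge connected (u , v , apart) {a , b} e∈ a-leaf b-leaf
    with trapped (proj₂ (connected a u)) (inj₁ refl) | trapped (proj₂ (connected a v)) (inj₁ refl)
    where
    -- the walks starting at a never leave {a, b}
    Ends : Fin p → Set
    Ends x = (x ≡ a) ⊎ (x ≡ b)
    trapped : ∀ {x z k} → Walk G x z k → Ends x → Ends z
    trapped here x∈ = x∈
    trapped (step x~y w) (inj₁ refl) = trapped w (inj₂ (leaf-neighbour-unique a-leaf x~y (inj₁ e∈)))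
    trapped (step x~y w) (inj₂ refl) = trapped w (inj₁ (leaf-neighbour-unique b-leaf x~y (inj₂ e∈)))
  ... | inj₁ refl | inj₁ refl = ℕ.≤⇒≯ z≤n (apart 0 here)
  ... | inj₂ refl | inj₂ refl = ℕ.≤⇒≯ z≤n (apart 0 here)
  ... | inj₁ refl | inj₂ refl = ℕ.≤⇒≯ (s≤s z≤n) (apart 1 (step (inj₁ e∈) here))
  ... | inj₂ refl | inj₁ refl = ℕ.≤⇒≯ (s≤s z≤n) (apart 1 (step (inj₂ e∈) here))

-- A graph whose non-leaf vertices form the path w 0 – w 1 – w 2 and in which no
-- edge joins two leaves: the shape of a caterpillar of diameter four.
record ThreeSpine {p : ℕ} (G : Graph p) : Set where
  field
    w : Fin 3 → Fin p
    w-injective : Injective _≡_ _≡_ w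
    w0~w1 : Adj G (w zero) (w (suc zero))
    w1~w2 : Adj G (w (suc zero)) (w (suc (suc zero)))
    w0≁w2 : ¬ Adj G (w zero) (w (suc (suc zero)))
    off-spine-leaf : ∀ v → ¬ (∃ λ i → w i ≡ v) → IsLeaf G v
    no-leaf-edge : ∀ {e} → e ∈ edges G → IsLeaf G (proj₁ e) → IsLeaf G (proj₂ e) → ⊥

-- Edges of a three-spine graph come in five kinds, according to the spine
-- vertices they meet; a sixth kind collects the impossible incidence patterns.
Kind : Set
Kind = Fin 6

pattern spine01  = zero
pattern spine12  = suc zero
pattern pendant0 = suc (suc zero)
pattern pendant1 = suc (suc (suc zero))
pattern pendant2 = suc (suc (suc (suc zero)))
pattern stray    = suc (suc (suc (suc (suc zero))))

triple : Bool → Bool → Bool → Fin 3 → Bool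
triple b₀ b₁ b₂ zero = b₀
triple b₀ b₁ b₂ (suc zero) = b₁
triple b₀ b₁ b₂ (suc (suc zero)) = b₂

meets : Kind → Fin 3 → Bool
meets spine01  = triple true true false
meets spine12  = triple false true true
meets pendant0 = triple true false false
meets pendant1 = triple false true false
meets pendant2 = triple false false true
meets stray    = triple false false false

classify : Bool → Bool → Bool → Kind
classify true  true  false = spine01
classify false true  true  = spine12
classify true  false false = pendant0
classify false true  false = pendant1
classify false false true  = pendant2
classify _     _     _     = stray

classify-meets : ∀ b₀ b₁ b₂ → classify b₀ b₁ b₂ ≢ stray → meets (classify b₀ b₁ b₂) ≡ triple b₀ b₁ b₂
classify-meets true  true  false _ = refl
classify-meets false true  true  _ = refl
classify-meets true  false false _ = refl
classify-meets false true  false _ = refl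
classify-meets false false true  _ = refl
classify-meets true  true  true  ¬stray = ⊥-elim (¬stray refl)
classify-meets true  false true  ¬stray = ⊥-elim (¬stray refl)
classify-meets false false false ¬stray = ⊥-elim (¬stray refl)

isPendant : Kind → Bool
isPendant pendant0 = true
isPendant pendant1 = true
isPendant pendant2 = true
isPendant _ = false

anchor : Kind → Fin 3
anchor pendant1 = suc zero
anchor pendant2 = suc (suc zero)
anchor _ = zero

anchor-met : ∀ X → isPendant X ≡ true → meets X (anchor X) ≡ true
anchor-met pendant0 _ = refl
anchor-met pendant1 _ = refl
anchor-met pendant2 _ = refl

only-anchor-met : ∀ X → isPendant X ≡ true → ∀ i → meets X i ≡ true → i ≡ anchor X
only-anchor-met pendant0 _ zero _ = refl
only-anchor-met pendant0 _ (suc zero) ()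
only-anchor-met pendant0 _ (suc (suc zero)) ()
only-anchor-met pendant1 _ zero ()
only-anchor-met pendant1 _ (suc zero) _ = refl
only-anchor-met pendant1 _ (suc (suc zero)) ()
only-anchor-met pendant2 _ zero ()
only-anchor-met pendant2 _ (suc zero) ()
only-anchor-met pendant2 _ (suc (suc zero)) _ = refl

two-met : ∀ X → isPendant X ≡ false → X ≢ stray → Σ (Fin 3) λ i → Σ (Fin 3) λ j → i ≢ j × meets X i ≡ true × meets X j ≡ true
two-met spine01 _ _ = zero , suc zero , (λ ()) , refl , refl
two-met spine12 _ _ = suc zero , suc (suc zero) , (λ ()) , refl , refl
two-met stray _ ¬stray = ⊥-elim (¬stray refl)

witness : ∀ {A : Set} (a? : Dec A) → does a? ≡ true → A
witness (yes a) _ = a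

does-true? : ∀ b → does (b Bool.≟ true) ≡ b
does-true? true = refl
does-true? false = refl

module ThreeSpineFacts {p : ℕ} (G : Graph p) (S : ThreeSpine G) where
  open ThreeSpine S public
  open GraphFacts G public

  es : List Edge
  es = edges G

  OnSpine : Fin p → Set
  OnSpine v = ∃ λ i → w i ≡ v

  onSpine? : ∀ v → Dec (OnSpine v)
  onSpine? v = Fin.any? (λ i → w i ≟ v)

  w-distinct : ∀ {i j} → i ≢ j → w i ≢ w j
  w-distinct i≢j = i≢j ∘ w-injective

  w₀ w₁ w₂ : Fin p
  w₀ = w zero
  w₁ = w (suc zero)
  w₂ = w (suc (suc zero))

  w₀≢w₁ : w₀ ≢ w₁
  w₀≢w₁ = w-distinct λ ()
  w₀≢w₂ : w₀ ≢ w₂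
  w₀≢w₂ = w-distinct λ ()
  w₁≢w₂ : w₁ ≢ w₂
  w₁≢w₂ = w-distinct λ ()

  kind : Edge → Kind
  kind e = classify (does (incident? G w₀ e)) (does (incident? G w₁ e)) (does (incident? G w₂ e))

  untouched-ends : ∀ {e} → (∀ i → ¬ Incident (w i) e) → ¬ OnSpine (proj₁ e) × ¬ OnSpine (proj₂ e)
  untouched-ends untouched = (λ { (i , refl) → untouched i (inj₁ refl) }) , (λ { (i , refl) → untouched i (inj₂ refl) })

  -- no edge meets all three spine vertices, joins w₀ and w₂, or joins two leaves
  not-stray : ∀ {e} → e ∈ es → kind e ≢ stray
  not-stray {e} e∈ = by-incidence (incident? G w₀ e) (incident? G w₁ e) (incident? G w₂ e)
    where
    by-incidence : (d₀ : Dec (Incident w₀ e)) (d₁ : Dec (Incident w₁ e)) (d₂ : Dec (Incident w₂ e)) →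
                   classify (does d₀) (does d₁) (does d₂) ≢ stray
    by-incidence (yes i₀) (yes i₁) (yes i₂) _ = no-three-ends i₀ i₁ i₂ w₀≢w₁ w₀≢w₂ w₁≢w₂
    by-incidence (yes i₀) (no _)   (yes i₂) _ = w0≁w2 (joins⇒adj e∈ (joins i₀ i₂ w₀≢w₂))
    by-incidence (no n₀)  (no n₁)  (no n₂)  _ =
      no-leaf-edge e∈ (off-spine-leaf _ (proj₁ ends)) (off-spine-leaf _ (proj₂ ends))
      where ends = untouched-ends λ { zero → n₀ ; (suc zero) → n₁ ; (suc (suc zero)) → n₂ }
    by-incidence (yes _) (yes _) (no _) ()
    by-incidence (yes _) (no _)  (no _) ()
    by-incidence (no _)  (yes _) (yes _) ()
    by-incidence (no _)  (yes _) (no _) ()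
    by-incidence (no _)  (no _)  (yes _) ()

  kind-meets : ∀ {e} → e ∈ es → ∀ i → does (incident? G (w i) e) ≡ meets (kind e) i
  kind-meets {e} e∈ i = trans (as-triple i) (sym (cong-app (classify-meets _ _ _ (not-stray e∈)) i))
    where
    as-triple : ∀ i → does (incident? G (w i) e) ≡
                triple (does (incident? G w₀ e)) (does (incident? G w₁ e)) (does (incident? G w₂ e)) i
    as-triple zero = refl
    as-triple (suc zero) = refl
    as-triple (suc (suc zero)) = refl

  meets⇒incident : ∀ {e i} → e ∈ es → meets (kind e) i ≡ true → Incident (w i) e
  meets⇒incident {e} {i} e∈ met = witness (incident? G (w i) e) (trans (kind-meets e∈ i) met)

  incident⇒meets : ∀ {e i} → e ∈ es → Incident (w i) e → meets (kind e) i ≡ true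
  incident⇒meets {e} {i} e∈ w∈e = trans (sym (kind-meets e∈ i)) (dec-true (incident? G (w i) e) w∈e)

  open Dealing kind public

  kind-by-incidence : ∀ e {b₀ b₁ b₂} → does (incident? G w₀ e) ≡ b₀ → does (incident? G w₁ e) ≡ b₁ →
                      does (incident? G w₂ e) ≡ b₂ → kind e ≡ classify b₀ b₁ b₂
  kind-by-incidence e refl refl refl = refl

  exactly-one : ∀ {X u v} → Adj G u v → (∀ {e} → e ∈ es → kind e ≡ X → Joins u v e) →
                (∀ {e} → Joins u v e → kind e ≡ X) → count X es ≡ 1
  exactly-one {X} u~v joined joining-kind = ℕ.≤-antisym
    (at-most-one-joining (ofKind X es) (Unique.filter⁺ _ (distinct G))
      (λ e∈ → let e∈es , is-X = ∈-filter⁻ (λ e → kind e ≟ X) e∈ in e∈es , joined e∈es is-X))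
    (member⇒nonempty (∈-filter⁺ (λ e → kind e ≟ X) e∈ (joining-kind uv)))
    where
    e∈ = proj₁ (proj₂ (adj⇒edge u~v))
    uv = proj₂ (proj₂ (adj⇒edge u~v))

  spine-joins : ∀ {e X} i j → e ∈ es → kind e ≡ X → meets X i ≡ true → meets X j ≡ true → i ≢ j → Joins (w i) (w j) e
  spine-joins i j e∈ refl met-i met-j i≢j = joins (meets⇒incident e∈ met-i) (meets⇒incident e∈ met-j) (w-distinct i≢j)

  count-spine01 : count spine01 es ≡ 1
  count-spine01 = exactly-one w0~w1 (λ e∈ is-X → spine-joins zero (suc zero) e∈ is-X refl refl λ ()) λ {e} j →
    kind-by-incidence e (dec-true (incident? G w₀ e) (proj₁ (joins-ends j)))
                        (dec-true (incident? G w₁ e) (proj₂ (joins-ends j)))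
                        (dec-false (incident? G w₂ e) (joins-only j (w₀≢w₂ ∘ sym) (w₁≢w₂ ∘ sym)))

  count-spine12 : count spine12 es ≡ 1
  count-spine12 = exactly-one w1~w2 (λ e∈ is-X → spine-joins (suc zero) (suc (suc zero)) e∈ is-X refl refl λ ())
                    λ {e} j →
    kind-by-incidence e (dec-false (incident? G w₀ e) (joins-only j w₀≢w₁ w₀≢w₂))
                        (dec-true (incident? G w₁ e) (proj₁ (joins-ends j)))
                        (dec-true (incident? G w₂ e) (proj₂ (joins-ends j)))

  count-stray : count stray es ≡ 0
  count-stray = cong length (filter-none (λ e → kind e ≟ stray) (All.tabulate not-stray))

  edge-count : size G ≡ 2 + count pendant0 es + count pendant1 es + count pendant2 es
  edge-count = trans (count-total es)
    (by-counts {a = count pendant0 es} {count pendant1 es} {count pendant2 es} count-spine01 count-spine12 count-stray)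
    where
    by-counts : ∀ {s₀₁ s₁₂ a b c s} → s₀₁ ≡ 1 → s₁₂ ≡ 1 → s ≡ 0 →
                s₀₁ + (s₁₂ + (a + (b + (c + (s + 0))))) ≡ 2 + a + b + c
    by-counts {a = a} {b} {c} refl refl refl = regroup-counts a b c
      where
      regroup-counts : ∀ a b c → 1 + (1 + (a + (b + (c + 0)))) ≡ 2 + a + b + c
      regroup-counts = solve-∀

  leafEnd : Edge → Fin p
  leafEnd e = other-end (w (anchor (kind e))) e

  pendant-end : ∀ {e} → e ∈ es → isPendant (kind e) ≡ true → ¬ OnSpine (leafEnd e) × Incident (leafEnd e) e
  pendant-end {e} e∈ pendant = off-spine , other-end-incident _ e
    where
    off-spine : ¬ OnSpine (leafEnd e)
    off-spine (j , wj≡) with only-anchor-met (kind e) pendant j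
                               (incident⇒meets e∈ (subst (λ v → Incident v e) (sym wj≡) (other-end-incident _ e)))
    ... | refl = other-end-differs e∈ (sym wj≡)

  off-spine-edge : ∀ {e ℓ} → e ∈ es → Incident ℓ e → ¬ OnSpine ℓ → isPendant (kind e) ≡ true × leafEnd e ≡ ℓ
  off-spine-edge {e} {ℓ} e∈ ℓ∈e off = pendant , other-end-is (meets⇒incident e∈ (anchor-met (kind e) pendant)) ℓ∈e
                                                (λ ℓ≡ → off (anchor (kind e) , sym ℓ≡))
    where
    pendant : isPendant (kind e) ≡ true
    pendant with isPendant (kind e) in not-pendant
    ... | true = refl
    ... | false with two-met (kind e) not-pendant (not-stray e∈)
    ...   | i , j , i≢j , met-i , met-j =
      ⊥-elim (no-three-ends (meets⇒incident e∈ met-i) (meets⇒incident e∈ met-j) ℓ∈e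
                            (w-distinct i≢j) (λ eq → off (i , eq)) (λ eq → off (j , eq)))

  module Labelled {k : ℕ} (D : Design (count pendant0 es) (count pendant1 es) (count pendant2 es) k) where
    open Design D

    pools : Pools
    pools spine01 = [ x ]
    pools spine12 = [ y ]
    pools pendant0 = LA
    pools pendant1 = LB
    pools pendant2 = LC
    pools stray = []

    pool-sizes : ∀ X → length (pools X) ≡ count X es
    pool-sizes spine01 = sym count-spine01
    pool-sizes spine12 = sym count-spine12
    pool-sizes pendant0 = size-A
    pool-sizes pendant1 = size-B
    pool-sizes pendant2 = size-C
    pool-sizes stray = sym count-stray

    f : Fin (size G) → ℤ
    f = deal pools es

    f⁺ : Fin p → ℤ
    f⁺ = inducedLabel G f

    ds : List (Edge × ℤ)
    ds = withLabels es f

    entry : ∀ {z} → z ∈ ds → proj₁ z ∈ es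
    entry z∈ = subst (_ ∈_) (withLabels-entries es f) (∈-map⁺ proj₁ z∈)

    at-vertex : ∀ v → f⁺ v ≡ sumℤ (map proj₂ (filter (incident? G v ∘ proj₁) ds))
    at-vertex v = cong sumℤ (labels-where es f (incident? G v))

    met? : ∀ i X → Dec (meets X i ≡ true)
    met? i X = meets X i Bool.≟ true

    spine-label : ∀ i → f⁺ (w i) ≡ sumℤ (concat (tabulate (pick (met? i) pools)))
    spine-label i = begin
      f⁺ (w i)                                                      ≡⟨ at-vertex (w i) ⟩
      sumℤ (map proj₂ (filter (incident? G (w i) ∘ proj₁) ds))      ≡⟨ cong (sumℤ ∘ map proj₂) (filter-cong _ _ ds decisions) ⟩
      sumℤ (map proj₂ (filter (met? i ∘ kind ∘ proj₁) ds))          ≡⟨ sumℤ-↭ (dealt (met? i) pools es pool-sizes) ⟩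
      sumℤ (concat (tabulate (pick (met? i) pools)))                ∎
      where
      open ≡-Reasoning
      decisions : ∀ {z} → z ∈ ds → does (incident? G (w i) (proj₁ z)) ≡ does (met? i (kind (proj₁ z)))
      decisions z∈ = trans (kind-meets (entry z∈) i) (sym (does-true? _))

    leaf-label : ∀ {z} → z ∈ ds → isPendant (kind (proj₁ z)) ≡ true → f⁺ (leafEnd (proj₁ z)) ≡ proj₂ z
    leaf-label {z} z∈ pendant = begin
      f⁺ ℓ                    ≡⟨ at-vertex ℓ ⟩
      sumℤ (map proj₂ at-ℓ)   ≡⟨ cong (sumℤ ∘ map proj₂) (only-member at-ℓ one-edge z∈at-ℓ) ⟩
      proj₂ z ℤ.+ + 0         ≡⟨ ℤ.+-identityʳ (proj₂ z) ⟩
      proj₂ z                 ∎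
      where
      open ≡-Reasoning
      ℓ = leafEnd (proj₁ z)
      at-ℓ = filter (incident? G ℓ ∘ proj₁) ds
      z∈at-ℓ : z ∈ at-ℓ
      z∈at-ℓ = ∈-filter⁺ (incident? G ℓ ∘ proj₁) z∈ (proj₂ (pendant-end (entry z∈) pendant))
      one-edge : length at-ℓ ≡ 1
      one-edge = begin
        length at-ℓ              ≡⟨ length-map proj₁ at-ℓ ⟨
        length (map proj₁ at-ℓ)  ≡⟨ cong length (filter-map proj₁ (incident? G ℓ) ds) ⟨
        length (filter (incident? G ℓ) (map proj₁ ds))  ≡⟨ cong (length ∘ filter (incident? G ℓ)) (withLabels-entries es f) ⟩
        degree G ℓ               ≡⟨ off-spine-leaf ℓ (proj₁ (pendant-end (entry z∈) pendant)) ⟩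
        1                        ∎

    edge-labels-ok : map f (allFin (size G)) ↭ x ∷ y ∷ LA ++ LB ++ LC
    edge-labels-ok = begin
      map f (allFin (size G))                          ≡⟨ cong (map f) (filter-all every (All.universal _ _)) ⟨
      map f (filter (every ∘ lookup es) (allFin (size G))) ≡⟨ labels-where es f every ⟩
      map proj₂ (filter every ds)                      ↭⟨ dealt every pools es pool-sizes ⟩
      x ∷ y ∷ LA ++ LB ++ LC ++ []                     ≡⟨ cong (λ L → x ∷ y ∷ LA ++ LB ++ L) (++-identityʳ LC) ⟩
      x ∷ y ∷ LA ++ LB ++ LC                           ∎
      where
      open PermutationReasoning
      every : ∀ {A : Set} (a : A) → Dec ⊤
      every _ = yes tt

    pendant? : ∀ X → Dec (isPendant X ≡ true)
    pendant? X = isPendant X Bool.≟ true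

    pendants : List (Edge × ℤ)
    pendants = filter (pendant? ∘ kind ∘ proj₁) ds

    spine-set : filter onSpine? (allFin p) ↭ tabulate w
    spine-set = unique-↭ (Unique.filter⁺ onSpine? (Unique.allFin⁺ p)) (Unique.tabulate⁺ w-injective) (mk⇔ to from)
      where
      to : ∀ {v} → v ∈ filter onSpine? (allFin p) → v ∈ tabulate w
      to v∈ with ∈-filter⁻ onSpine? {xs = allFin p} v∈
      ... | _ , (i , refl) = ∈-tabulate⁺ {f = w} i
      from : ∀ {v} → v ∈ tabulate w → v ∈ filter onSpine? (allFin p)
      from v∈ with ∈-tabulate⁻ {f = w} v∈
      ... | i , refl = ∈-filter⁺ onSpine? (∈-allFin _) (i , refl)

    off-set : filter (¬? ∘ onSpine?) (allFin p) ↭ map (leafEnd ∘ proj₁) pendants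
    off-set = unique-↭ (Unique.filter⁺ (¬? ∘ onSpine?) (Unique.allFin⁺ p))
                       (unique-map-on proj₁ (leafEnd ∘ proj₁) unique-edges same-end) (mk⇔ to from)
      where
      unique-edges : Unique (map proj₁ pendants)
      unique-edges = subst Unique (trans (cong (filter (pendant? ∘ kind)) (sym (withLabels-entries es f)))
                                         (filter-map proj₁ (pendant? ∘ kind) ds))
                                  (Unique.filter⁺ (pendant? ∘ kind) (distinct G))
      pendant-entry : ∀ {z} → z ∈ pendants → proj₁ z ∈ es × isPendant (kind (proj₁ z)) ≡ true
      pendant-entry z∈ = let z∈ds , pendant = ∈-filter⁻ (pendant? ∘ kind ∘ proj₁) z∈ in entry z∈ds , pendant
      same-end : ∀ {z z′} → z ∈ pendants → z′ ∈ pendants → leafEnd (proj₁ z) ≡ leafEnd (proj₁ z′) → proj₁ z ≡ proj₁ z′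
      same-end z∈ z′∈ ends≡ with pendant-entry z∈ | pendant-entry z′∈
      ... | e∈ , pendant | e′∈ , pendant′ =
        leaf-edge (off-spine-leaf _ (proj₁ (pendant-end e∈ pendant))) e∈ e′∈ (proj₂ (pendant-end e∈ pendant))
                  (subst (λ v → Incident v _) (sym ends≡) (proj₂ (pendant-end e′∈ pendant′)))
      to : ∀ {ℓ} → ℓ ∈ filter (¬? ∘ onSpine?) (allFin p) → ℓ ∈ map (leafEnd ∘ proj₁) pendants
      to {ℓ} ℓ∈ with ∈-filter⁻ (¬? ∘ onSpine?) {xs = allFin p} ℓ∈
      ... | _ , off with adj⇒edge (proj₂ (leaf-neighbour (off-spine-leaf ℓ off)))
      ... | e , e∈ , ℓe with off-spine-edge e∈ (proj₁ (joins-ends ℓe)) off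
                           | ∈-map⁻ proj₁ (subst (e ∈_) (sym (withLabels-entries es f)) e∈)
      ... | pendant , end≡ | z , z∈ds , refl =
        subst (_∈ _) end≡ (∈-map⁺ (leafEnd ∘ proj₁) (∈-filter⁺ (pendant? ∘ kind ∘ proj₁) z∈ds pendant))
      from : ∀ {ℓ} → ℓ ∈ map (leafEnd ∘ proj₁) pendants → ℓ ∈ filter (¬? ∘ onSpine?) (allFin p)
      from ℓ∈ with ∈-map⁻ (leafEnd ∘ proj₁) ℓ∈
      ... | z , z∈ , refl = ∈-filter⁺ (¬? ∘ onSpine?) (∈-allFin _)
                               (proj₁ (pendant-end (proj₁ (pendant-entry z∈)) (proj₂ (pendant-entry z∈))))

    vertex-labels-ok : map f⁺ (allFin p) ↭ + 0 ∷ x ∷ y ∷ LA ++ LB ++ LC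
    vertex-labels-ok = begin
      map f⁺ (allFin p)                                          ↭⟨ Perm.map⁺ f⁺ (filter-split onSpine? (allFin p)) ⟩
      map f⁺ (filter onSpine? (allFin p) ++ filter (¬? ∘ onSpine?) (allFin p))
                                                                 ≡⟨ map-++ f⁺ (filter onSpine? (allFin p)) _ ⟩
      map f⁺ (filter onSpine? (allFin p)) ++ map f⁺ (filter (¬? ∘ onSpine?) (allFin p))
                                                                 ↭⟨ ++⁺ (Perm.map⁺ f⁺ spine-set) (Perm.map⁺ f⁺ off-set) ⟩
      (f⁺ w₀ ∷ f⁺ w₁ ∷ f⁺ w₂ ∷ []) ++ map f⁺ (map (leafEnd ∘ proj₁) pendants)
                                                                 ≡⟨ cong₂ _++_ spine-values leaf-values ⟩
      ((x ℤ.+ sumℤ LA) ∷ (x ℤ.+ (y ℤ.+ sumℤ LB)) ∷ (y ℤ.+ sumℤ LC) ∷ []) ++ map proj₂ pendants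
                                                                 ↭⟨ ++⁺ spine-sums (dealt pendant? pools es pool-sizes) ⟩
      (+ 0 ∷ x ∷ y ∷ []) ++ LA ++ LB ++ LC ++ []                 ≡⟨ cong (λ L → + 0 ∷ x ∷ y ∷ LA ++ LB ++ L) (++-identityʳ LC) ⟩
      + 0 ∷ x ∷ y ∷ LA ++ LB ++ LC                               ∎
      where
      open PermutationReasoning
      without-[] : ∀ (u : ℤ) L → u ℤ.+ sumℤ (L ++ []) ≡ u ℤ.+ sumℤ L
      without-[] u L = cong (λ L′ → u ℤ.+ sumℤ L′) (++-identityʳ L)
      spine-values : f⁺ w₀ ∷ f⁺ w₁ ∷ f⁺ w₂ ∷ [] ≡ (x ℤ.+ sumℤ LA) ∷ (x ℤ.+ (y ℤ.+ sumℤ LB)) ∷ (y ℤ.+ sumℤ LC) ∷ []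
      spine-values = cong₂ _∷_ (trans (spine-label zero) (without-[] x LA))
                    (cong₂ _∷_ (trans (spine-label (suc zero)) (cong (λ s → x ℤ.+ s) (without-[] y LB)))
                    (cong (_∷ []) (trans (spine-label (suc (suc zero))) (without-[] y LC))))
      leaf-values : map f⁺ (map (leafEnd ∘ proj₁) pendants) ≡ map proj₂ pendants
      leaf-values = trans (sym (map-∘ pendants)) (map-cong-∈ _ proj₂ pendants λ z∈ →
        let z∈ds , pendant = ∈-filter⁻ (pendant? ∘ kind ∘ proj₁) z∈ in leaf-label z∈ds pendant)

three-spine-super-edge-graceful : ∀ {p} (G : Graph p) → ThreeSpine G → ∀ k → size G ≡ 2 * k → SuperEdgeGraceful G
three-spine-super-edge-graceful {p} G S k q≡2k = f , edges-ok , vertices-ok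
  where
  open ThreeSpineFacts G S
  D = design (count pendant0 es) (count pendant1 es) (count pendant2 es) k (trans (sym edge-count) q≡2k)
  open Labelled D
  open Design D using (x; y; LA; LB; LC; edge-labels)

  edges-ok : map f (allFin (size G)) ↭ labels (size G)
  edges-ok = begin
    map f (allFin (size G))                                  ↭⟨ edge-labels-ok ⟩
    x ∷ y ∷ LA ++ LB ++ LC                                   ↭⟨ edge-labels ⟩
    pm k                                                     ≡⟨ labels-even k ⟨
    labels (2 * k)                                           ≡⟨ cong labels q≡2k ⟨
    labels (size G)                                          ∎
    where open PermutationReasoning

  all-vertex-labels : map f⁺ (allFin p) ↭ + 0 ∷ pm k
  all-vertex-labels = ↭-trans vertex-labels-ok (prep (+ 0) edge-labels)

  -- p = q + 1, read off from the number of vertex labels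
  p≡ : p ≡ suc (2 * k)
  p≡ = begin
    p                          ≡⟨ length-tabulate (λ i → i) ⟨
    length (allFin p)          ≡⟨ length-map f⁺ (allFin p) ⟨
    length (map f⁺ (allFin p)) ≡⟨ ↭-length all-vertex-labels ⟩
    suc (length (pm k))        ≡⟨ cong suc (length-pm k) ⟩
    suc (2 * k)                ∎
    where open ≡-Reasoning

  vertices-ok : map f⁺ (allFin p) ↭ labels p
  vertices-ok = ↭-trans all-vertex-labels (↭-reflexive (sym (trans (cong labels p≡) (labels-odd k))))

module CaterpillarSpine {p : ℕ} (G : Graph p) (m : ℕ) (w : Fin m → Fin p) (w-injective : Injective _≡_ _≡_ w)
  (non-leaf⇔spine : ∀ v → (¬ IsLeaf G v) ⇔ (∃ λ i → w i ≡ v))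
  (adj⇔consecutive : ∀ i j → Adj G (w i) (w j) ⇔ ((toℕ j ≡ suc (toℕ i)) ⊎ (toℕ i ≡ suc (toℕ j))))
  (close : ∀ u v → ∃ λ k → k ≤ 4 × Walk G u v k)
  (far : ∃ λ u → ∃ λ v → ∀ k → Walk G u v k → 4 ≤ k) where

  open GraphFacts G

  OnSpine : Fin p → Set
  OnSpine v = ∃ λ i → w i ≡ v

  onSpine? : ∀ v → Dec (OnSpine v)
  onSpine? v = Fin.any? (λ i → w i ≟ v)

  off-spine-leaf : ∀ v → ¬ OnSpine v → IsLeaf G v
  off-spine-leaf v off with degree G v ℕ.≟ 1
  ... | yes leaf = leaf
  ... | no not-leaf = ⊥-elim (off (Equivalence.to (non-leaf⇔spine v) not-leaf))

  spine-not-leaf : ∀ i → ¬ IsLeaf G (w i)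
  spine-not-leaf i = Equivalence.from (non-leaf⇔spine (w i)) (i , refl)

  no-leaf-edge : ∀ {e} → e ∈ edges G → IsLeaf G (proj₁ e) → IsLeaf G (proj₂ e) → ⊥
  no-leaf-edge = spread⇒no-leaf-edge (λ u v → let k , _ , walk = close u v in k , walk)
                   (let u , v , apart = far in u , v , λ k walk → ℕ.≤-trans (s≤s (s≤s z≤n)) (apart k walk))

  leaves-not-adjacent : ∀ {x y} → Adj G x y → IsLeaf G x → IsLeaf G y → ⊥
  leaves-not-adjacent (inj₁ xy) x-leaf y-leaf = no-leaf-edge xy x-leaf y-leaf
  leaves-not-adjacent (inj₂ yx) x-leaf y-leaf = no-leaf-edge yx y-leaf x-leaf

  near-spine : ∀ v → Σ (Fin m) λ i → Σ ℕ λ k → k ≤ 1 × Walk G v (w i) k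
  near-spine v with onSpine? v
  ... | yes (i , refl) = i , 0 , z≤n , here
  ... | no off with leaf-neighbour (off-spine-leaf v off)
  ...   | y , v~y with onSpine? y
  ...     | yes (i , refl) = i , 1 , s≤s z≤n , step v~y here
  ...     | no y-off = ⊥-elim (leaves-not-adjacent v~y (off-spine-leaf v off) (off-spine-leaf y y-off))

  -- A spine of at most two vertices would bring all vertices within distance three.
  short-spine : (∀ i j → Σ ℕ λ k → k ≤ 1 × Walk G (w i) (w j) k) → ⊥
  short-spine spine-close =
    let u , v , apart = far
        i , _ , k≤1 , u→wi = near-spine u
        j , _ , l≤1 , v→wj = near-spine v
        _ , n≤1 , wi→wj = spine-close i j
    in ℕ.<⇒≱ (s≤s (ℕ.+-mono-≤ k≤1 (ℕ.+-mono-≤ n≤1 l≤1))) (apart _ (u→wi ++ʷ (wi→wj ++ʷ reverseʷ v→wj)))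

  anchor? : ∀ v → Dec (∃ λ j → Adj G v (w j))
  anchor? v = Fin.any? (λ j → adj? v (w j))

  -- A height function that grows by at most one along each edge: w i has height
  -- i + 1, a leaf at w 0 has height 0 and a leaf at w j (j ≥ 1) has height j + 2.
  leaf-height : ℕ → ℕ
  leaf-height zero = zero
  leaf-height (suc j) = suc (suc (suc j))

  height-from : ∀ v → Dec (OnSpine v) → Dec (∃ λ j → Adj G v (w j)) → ℕ
  height-from v (yes (i , _)) _ = suc (toℕ i)
  height-from v (no _) (yes (j , _)) = leaf-height (toℕ j)
  height-from v (no _) (no _) = zero

  height : Fin p → ℕ
  height v = height-from v (onSpine? v) (anchor? v)

  leaf-height-from : ∀ {v j} → ¬ OnSpine v → Adj G v (w j) → ∀ d d′ → height-from v d d′ ≡ leaf-height (toℕ j)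
  leaf-height-from off v~wj (yes on) _ = ⊥-elim (off on)
  leaf-height-from {v} off v~wj (no _) (yes (j′ , v~wj′)) =
    cong (leaf-height ∘ toℕ) (w-injective (leaf-neighbour-unique (off-spine-leaf v off) v~wj′ v~wj))
  leaf-height-from {j = j} off v~wj (no _) (no none) = ⊥-elim (none (j , v~wj))

  height-leaf : ∀ {v j} → ¬ OnSpine v → Adj G v (w j) → height v ≡ leaf-height (toℕ j)
  height-leaf {v} off v~wj = leaf-height-from off v~wj (onSpine? v) (anchor? v)

  height-step : ∀ {x y} → Adj G x y → height y ≤ suc (height x)
  height-step {x} {y} x~y with onSpine? x | onSpine? y
  ... | yes (i , refl) | yes (j , refl) = consecutive (Equivalence.to (adj⇔consecutive i j) x~y)
    where
    consecutive : (toℕ j ≡ suc (toℕ i)) ⊎ (toℕ i ≡ suc (toℕ j)) → suc (toℕ j) ≤ suc (suc (toℕ i))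
    consecutive (inj₁ j≡1+i) = s≤s (ℕ.≤-reflexive j≡1+i)
    consecutive (inj₂ i≡1+j) = s≤s (ℕ.m≤n⇒m≤1+n (ℕ.≤-trans (ℕ.n≤1+n _) (ℕ.≤-reflexive (sym i≡1+j))))
  ... | yes (i , refl) | no y-off =
    subst (_≤ _) (sym (leaf-height-from y-off (adj-sym x~y) (no y-off) (anchor? y))) (below (toℕ i))
    where
    below : ∀ j → leaf-height j ≤ suc (suc j)
    below zero = z≤n
    below (suc j) = ℕ.≤-refl
  ... | no x-off | yes (j , refl) =
    subst (λ h → suc (toℕ j) ≤ suc h) (sym (leaf-height-from x-off x~y (no x-off) (anchor? x))) (s≤s (above (toℕ j)))
    where
    above : ∀ j → j ≤ leaf-height j
    above zero = z≤n
    above (suc j) = ℕ.≤-trans (ℕ.n≤1+n _) (ℕ.n≤1+n _)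
  ... | no x-off | no y-off = ⊥-elim (leaves-not-adjacent x~y (off-spine-leaf x x-off) (off-spine-leaf y y-off))

  height-walk : ∀ {x y k} → Walk G x y k → height y ≤ height x + k
  height-walk {x} here = ℕ.m≤m+n (height x) 0
  height-walk {x} {k = suc k} (step x~z walk) = ℕ.≤-trans (height-walk walk)
    (ℕ.≤-trans (ℕ.+-monoˡ-≤ k (height-step x~z)) (ℕ.≤-reflexive (sym (ℕ.+-suc (height x) k))))

  -- An end of the spine (a spine vertex with a single spine neighbour) carries a
  -- leaf, since spine vertices are not leaves.
  end-leaf : ∀ i i′ → Adj G (w i) (w i′) → (∀ j → Adj G (w i) (w j) → j ≡ i′) →
             Σ (Fin p) λ ℓ → ¬ OnSpine ℓ × Adj G ℓ (w i)
  end-leaf i i′ wi~wi′ only-i′ with Fin.any? (λ v → adj? (w i) v ×-dec ¬? (onSpine? v))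
  ... | yes (ℓ , wi~ℓ , off) = ℓ , off , adj-sym wi~ℓ
  ... | no none = ⊥-elim (spine-not-leaf i (degree-one wi~wi′ only-wi′))
    where
    only-wi′ : ∀ y → Adj G (w i) y → y ≡ w i′
    only-wi′ y wi~y with onSpine? y
    ... | yes (j , refl) = cong w (only-i′ j wi~y)
    ... | no off = ⊥-elim (none (y , wi~y , off))

  -- A spine of four or more vertices would put the leaves at its two ends at
  -- distance at least five.
  long-spine : (first second penult last : Fin m) → toℕ first ≡ 0 → toℕ second ≡ 1 →
               suc (toℕ penult) ≡ toℕ last → suc (toℕ last) ≡ m → 4 ≤ m → ⊥
  long-spine first second penult last first≡0 second≡1 penult+1≡last last+1≡m 4≤m =
    let ℓ₀ , ℓ₀-off , ℓ₀~first = end-leaf first second first~second only-second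
        ℓ₁ , ℓ₁-off , ℓ₁~last = end-leaf last penult last~penult only-penult
        k , k≤4 , ℓ₀→ℓ₁ = close ℓ₀ ℓ₁
        height-ℓ₀ : height ℓ₀ ≡ 0
        height-ℓ₀ = trans (height-leaf ℓ₀-off ℓ₀~first) (cong leaf-height first≡0)
        height-ℓ₁ : height ℓ₁ ≡ suc m
        height-ℓ₁ = trans (height-leaf ℓ₁-off ℓ₁~last)
                          (trans (cong leaf-height (sym penult+1≡last)) (cong suc (trans (cong suc penult+1≡last) last+1≡m)))
    in ℕ.<⇒≱ (s≤s 4≤m) (ℕ.≤-trans (subst₂ _≤_ height-ℓ₁ (cong (_+ k) height-ℓ₀) (height-walk ℓ₀→ℓ₁)) k≤4)
    where
    first~second : Adj G (w first) (w second)
    first~second = Equivalence.from (adj⇔consecutive first second) (inj₁ (trans second≡1 (cong suc (sym first≡0))))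
    only-second : ∀ j → Adj G (w first) (w j) → j ≡ second
    only-second j first~j with Equivalence.to (adj⇔consecutive first j) first~j
    ... | inj₁ j≡1+first = Fin.toℕ-injective (trans j≡1+first (trans (cong suc first≡0) (sym second≡1)))
    ... | inj₂ first≡1+j with () ← trans (sym first≡0) first≡1+j
    last~penult : Adj G (w last) (w penult)
    last~penult = Equivalence.from (adj⇔consecutive last penult) (inj₂ (sym penult+1≡last))
    only-penult : ∀ j → Adj G (w last) (w j) → j ≡ penult
    only-penult j last~j with Equivalence.to (adj⇔consecutive last j) last~j
    ... | inj₁ j≡1+last = ⊥-elim (ℕ.<-irrefl (trans j≡1+last last+1≡m) (Fin.toℕ<n j))
    ... | inj₂ last≡1+j = Fin.toℕ-injective (ℕ.suc-injective (trans (sym last≡1+j) (sym penult+1≡last)))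

caterpillar-three-spine : ∀ {p} (G : Graph p) → IsCaterpillar G → HasDiameter G 4 → ThreeSpine G
caterpillar-three-spine {p} G (_ , m , w , w-injective , non-leaf⇔spine , adj⇔consecutive) (close , far) =
  by-length m w w-injective non-leaf⇔spine adj⇔consecutive
  where
  by-length : ∀ m (w : Fin m → Fin p) → Injective _≡_ _≡_ w → (∀ v → (¬ IsLeaf G v) ⇔ (∃ λ i → w i ≡ v)) →
              (∀ i j → Adj G (w i) (w j) ⇔ ((toℕ j ≡ suc (toℕ i)) ⊎ (toℕ i ≡ suc (toℕ j)))) → ThreeSpine G
  by-length 0 w inj spine adj = ⊥-elim (short-spine λ ())
    where open CaterpillarSpine G 0 w inj spine adj close far
  by-length 1 w inj spine adj = ⊥-elim (short-spine λ { zero zero → 0 , z≤n , here })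
    where open CaterpillarSpine G 1 w inj spine adj close far
  by-length 2 w inj spine adj = ⊥-elim (short-spine within-one)
    where
    open CaterpillarSpine G 2 w inj spine adj close far
    within-one : ∀ i j → Σ ℕ λ k → k ≤ 1 × Walk G (w i) (w j) k
    within-one zero zero = 0 , z≤n , here
    within-one zero (suc zero) = 1 , s≤s z≤n , step (Equivalence.from (adj zero (suc zero)) (inj₁ refl)) here
    within-one (suc zero) zero = 1 , s≤s z≤n , step (Equivalence.from (adj (suc zero) zero) (inj₂ refl)) here
    within-one (suc zero) (suc zero) = 0 , z≤n , here
  by-length 3 w inj spine adj = record
    { w = w
    ; w-injective = inj
    ; w0~w1 = Equivalence.from (adj zero (suc zero)) (inj₁ refl)
    ; w1~w2 = Equivalence.from (adj (suc zero) (suc (suc zero))) (inj₁ refl)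
    ; w0≁w2 = λ w0~w2 → not-consecutive (Equivalence.to (adj zero (suc (suc zero))) w0~w2)
    ; off-spine-leaf = off-spine-leaf
    ; no-leaf-edge = no-leaf-edge
    }
    where
    open CaterpillarSpine G 3 w inj spine adj close far
    not-consecutive : ¬ ((2 ≡ 1) ⊎ (0 ≡ 3))
    not-consecutive (inj₁ ())
    not-consecutive (inj₂ ())
  by-length (suc (suc (suc (suc n)))) w inj spine adj =
    ⊥-elim (long-spine zero (suc zero) (inject₁ (fromℕ (2 + n))) (fromℕ (3 + n)) refl refl
              (trans (cong suc (trans (Fin.toℕ-inject₁ (fromℕ (2 + n))) (Fin.toℕ-fromℕ (2 + n)))) (sym (Fin.toℕ-fromℕ (3 + n))))
              (cong suc (Fin.toℕ-fromℕ (3 + n))) (s≤s (s≤s (s≤s (s≤s z≤n)))))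
    where open CaterpillarSpine G (4 + n) w inj spine adj close far

theorem1 : (p : ℕ) (G : Graph p) → IsCaterpillar G → HasDiameter G 4 →
           Σ ℕ (λ k → size G ≡ 2 * k) → SuperEdgeGraceful G
theorem1 p G caterpillar diameter-4 (k , q≡2k) =
  three-spine-super-edge-graceful G (caterpillar-three-spine G caterpillar diameter-4) k q≡2k
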